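{- Let $G$ be a connected graph of order $n\ge2$ and let $H$ be the graph consisting of $k\ge2$ isolated vertices (i.e. all $k$ connected components $H_1,\dots,H_k$ of $H$ are single vertices). Then $Z(G\circ H)\le nk-2$.
   Context: Zero forcing: given a set $S$ of initially black vertices (others white), the color-change rule turns a white vertex black if it is the only white neighbor of some black vertex; $S$ is a zero forcing set if eventually all vertices become black; $Z(G)$ is the minimum size of a zero forcing set. The lexicographic product $G\circ H$ has vertex set $V(G)\times V(H)$, with $(a,v)$ adjacent to $(b,w)$ iff $ab\in E(G)$, or $a=b$ and $vw\in E(H)$. -}

module Defs where

open import Data.Nat using (ℕ)
open import Data.Fin using (Fin)
open import Data.Product using (_×_; _,_; Σ; ∃-syntax)
open import Data.Sum using (_⊎_)
open import Data.Empty using (⊥)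
open import Data.List using (List; length)
open import Data.List.Membership.Propositional using (_∈_)
open import Data.List.Relation.Unary.Unique.Propositional using (Unique)
open import Relation.Nullary using (¬_)
open import Relation.Binary.PropositionalEquality using (_≡_)
open import Level using (0ℓ)

record Graph (V : Set) : Set₁ where
  field
    Adj   : V → V → Set
    sym   : ∀ {u v} → Adj u v → Adj v u
    irrefl : ∀ {v} → ¬ Adj v v
open Graph public

data Walk {V : Set} (G : Graph V) : V → V → Set where
  here : ∀ {v} → Walk G v v
  step : ∀ {u w v} → Adj G u w → Walk G w v → Walk G u v

Connected : {V : Set} → Graph V → Set
Connected G = ∀ u v → Walk G u v

-- Black G S v : vertex v is eventually black when S is the set
-- of initially black vertices (least closure under the colour-change rule:
-- a black vertex u all of whose neighbours other than v are black forces its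
-- (only white) neighbour v).
data Black {V : Set} (G : Graph V) (S : List V) : V → Set where
  init  : ∀ {v} → v ∈ S → Black G S v
  force : ∀ {u v} → Black G S u → Adj G u v →
          (∀ w → Adj G u w → ¬ (w ≡ v) → Black G S w) → Black G S v

IsZeroForcingSet : {V : Set} → Graph V → List V → Set
IsZeroForcingSet G S = ∀ v → Black G S v

open import Data.Nat using (_≤_)
Z≤ : {V : Set} → Graph V → ℕ → Set
Z≤ {V} G m = Σ (List V) λ S → Unique S × IsZeroForcingSet G S × length S ≤ m

lex : {A B : Set} → Graph A → Graph B → Graph (A × B)
lex G H = record
  { Adj = λ { (a , v) (b , w) → Adj G a b ⊎ (a ≡ b × Adj H v w) }
  ; sym = λ { (Data.Sum.inj₁ p) → Data.Sum.inj₁ (sym G p)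
            ; (Data.Sum.inj₂ (Relation.Binary.PropositionalEquality.refl , q)) →
                Data.Sum.inj₂ (Relation.Binary.PropositionalEquality.refl , sym H q) }
  ; irrefl = λ { (Data.Sum.inj₁ p) → irrefl G p ; (Data.Sum.inj₂ (_ , q)) → irrefl H q }
  }

empty : (k : ℕ) → Graph (Fin k)
empty k = record { Adj = λ _ _ → ⊥ ; sym = λ () ; irrefl = λ () }

module Submission where

-- Connectivity and n ≥ 2 give an edge ab of G.  Colour black every
-- vertex of G ∘ H except x = (a,0) and y = (b,0).  The vertex (a,1) is black,
-- adjacent to y, and not adjacent to x (H has no edges), so y is its only
-- white neighbour and it forces y; then (b,1) has x as its only white
-- neighbour and forces x.

open import Defs
open import Data.Nat using (ℕ; _≤_; _<_; _*_; _∸_; _+_; s≤s)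
open import Data.Nat.Properties using (∸-monoˡ-≤; ≤-reflexive; ≤-trans)
open import Data.Fin using (Fin) renaming (zero to fzero; suc to fsuc)
import Data.Fin.Properties as Fin
open import Data.Product using (_×_; _,_; Σ; ∃-syntax)
open import Data.Product.Properties using (≡-dec)
open import Data.Sum using (inj₁)
open import Data.Empty using (⊥-elim)
open import Data.List using (List; []; _∷_; length; filter; map; cartesianProduct; allFin)
open import Data.List.Properties using (filter-notAll; length-++; length-map; length-tabulate)
open import Data.List.Membership.Propositional using (_∈_)
open import Data.List.Membership.Propositional.Properties using (∈-filter⁺; ∈-cartesianProduct⁺; ∈-allFin)
import Data.List.Relation.Unary.Any as Any
open import Data.List.Relation.Unary.Unique.Propositional using (Unique)
import Data.List.Relation.Unary.Unique.Propositional.Properties as Unique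
open import Relation.Nullary using (¬_; yes; no; ¬?)
open import Relation.Binary.Definitions using (DecidableEquality)
open import Relation.Binary.PropositionalEquality using (_≡_; refl; cong₂; trans) renaming (sym to ≡-sym)

module Removal {A : Set} (_≟_ : DecidableEquality A) where

  remove : A → List A → List A
  remove x = filter (λ v → ¬? (v ≟ x))

  ∈-remove⁺ : ∀ {x v xs} → v ∈ xs → ¬ v ≡ x → v ∈ remove x xs
  ∈-remove⁺ {x} = ∈-filter⁺ (λ v → ¬? (v ≟ x))

  remove-shrinks : ∀ {x} xs → x ∈ xs → length (remove x xs) < length xs
  remove-shrinks {x} xs x∈xs =
    filter-notAll (λ v → ¬? (v ≟ x)) xs (Any.map (λ x≡v v≢x → v≢x (≡-sym x≡v)) x∈xs)

  unique-remove : ∀ {x xs} → Unique xs → Unique (remove x xs)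
  unique-remove {x} = Unique.filter⁺ (λ v → ¬? (v ≟ x))

record Listing (V : Set) (N : ℕ) : Set where
  field
    elements : List V
    unique   : Unique elements
    complete : ∀ v → v ∈ elements
    size     : length elements ≡ N

length-cartesianProduct : {A B : Set} (xs : List A) (ys : List B) →
                          length (cartesianProduct xs ys) ≡ length xs * length ys
length-cartesianProduct [] ys = refl
length-cartesianProduct (x ∷ xs) ys =
  trans (length-++ (map (x ,_) ys)) (cong₂ _+_ (length-map (x ,_) ys) (length-cartesianProduct xs ys))

listing-Fin× : (n k : ℕ) → Listing (Fin n × Fin k) (n * k)
listing-Fin× n k = record
  { elements = cartesianProduct (allFin n) (allFin k)
  ; unique   = Unique.cartesianProduct⁺ (Unique.allFin⁺ n) (Unique.allFin⁺ k)
  ; complete = λ (i , j) → ∈-cartesianProduct⁺ (∈-allFin i) (∈-allFin j)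
  ; size     = trans (length-cartesianProduct (allFin n) (allFin k))
                     (cong₂ _*_ (length-tabulate {n = n} (λ i → i)) (length-tabulate {n = k} (λ j → j)))
  }

allButTwo : {V : Set} {N : ℕ} → DecidableEquality V → Listing V N → {x y : V} → ¬ x ≡ y →
            Σ (List V) λ S → Unique S × (∀ v → ¬ v ≡ x → ¬ v ≡ y → v ∈ S) × length S ≤ N ∸ 2
allButTwo {V} {N} _≟_ L {x} {y} x≢y = S , unique-remove (unique-remove unique) , covers , bound
  where
  open Listing L
  open Removal _≟_
  S : List V
  S = remove y (remove x elements)

  covers : ∀ v → ¬ v ≡ x → ¬ v ≡ y → v ∈ S
  covers v v≢x v≢y = ∈-remove⁺ (∈-remove⁺ (complete v) v≢x) v≢y

  -- Each removal shrinks the list, so 2 + |S| ≤ N; subtract 2 on both sides.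
  bound : length S ≤ N ∸ 2
  bound = ∸-monoˡ-≤ 2 (≤-trans (s≤s removeY-shrinks) (≤-trans removeX-shrinks (≤-reflexive size)))
    where
    removeX-shrinks : length (remove x elements) < length elements
    removeX-shrinks = remove-shrinks elements (complete x)
    removeY-shrinks : length S < length (remove x elements)
    removeY-shrinks = remove-shrinks (remove x elements) (∈-remove⁺ (complete y) (λ y≡x → x≢y (≡-sym y≡x)))

-- Then x′ forces y (its only
-- white neighbour) and afterwards y′ forces x.  Distinctness x′ ≢ y and y′ ≢ x
-- follows from irreflexivity.
forceTwo : {V : Set} → DecidableEquality V → (G : Graph V) {x y x′ y′ : V} →
           ¬ x′ ≡ x → ¬ y′ ≡ y → Adj G x′ y → ¬ Adj G x′ x → Adj G y′ x →
           (S : List V) → (∀ v → ¬ v ≡ x → ¬ v ≡ y → v ∈ S) → IsZeroForcingSet G S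
forceTwo _≟_ G {x} {y} {x′} {y′} x′≢x y′≢y x′~y x′≁x y′~x S covers = everyBlack
  where
  adj-distinct : ∀ {u v} → Adj G u v → ¬ u ≡ v
  adj-distinct u~v refl = irrefl G u~v

  y-black : Black G S y
  y-black = force (init (covers x′ x′≢x (adj-distinct x′~y))) x′~y
    λ w x′~w w≢y → init (covers w (λ { refl → x′≁x x′~w }) w≢y)

  x-black : Black G S x
  x-black = force (init (covers y′ (adj-distinct y′~x) y′≢y)) y′~x
    λ w _ w≢x → blackUnlessY w w≢x
    where
    blackUnlessY : ∀ w → ¬ w ≡ x → Black G S w
    blackUnlessY w w≢x with w ≟ y
    ... | yes refl = y-black
    ... | no w≢y   = init (covers w w≢x w≢y)

  everyBlack : ∀ v → Black G S v
  everyBlack v with v ≟ x | v ≟ y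
  ... | yes refl | _        = x-black
  ... | no _     | yes refl = y-black
  ... | no v≢x   | no v≢y   = init (covers v v≢x v≢y)

lex-lift : {A B : Set} (G : Graph A) (H : Graph B) {a b : A} (i j : B) →
           Adj G a b → Adj (lex G H) (a , i) (b , j)
lex-lift G H i j a~b = inj₁ a~b

lex-empty-column : {A : Set} (G : Graph A) (k : ℕ) {a : A} (i j : Fin k) →
                   ¬ Adj (lex G (empty k)) (a , i) (a , j)
lex-empty-column G k i j (inj₁ a~a) = irrefl G a~a

walk-first-edge : {V : Set} {G : Graph V} {u v : V} → Walk G u v → ¬ u ≡ v → ∃[ w ] Adj G u w
walk-first-edge here         u≢u = ⊥-elim (u≢u refl)
walk-first-edge (step u~w _) _   = _ , u~w

mainTheorem18 : (n k : ℕ) → 2 ≤ n → 2 ≤ k → (G : Graph (Fin n)) → Connected G →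
                  Z≤ (lex G (empty k)) (n * k ∸ 2)
mainTheorem18 n k (s≤s (s≤s _)) (s≤s (s≤s _)) G connected =
  fromEdge (walk-first-edge (connected fzero (fsuc fzero)) (λ ()))
  where
  _≟_ : DecidableEquality (Fin n × Fin k)
  _≟_ = ≡-dec Fin._≟_ Fin._≟_

  -- From an edge ab of G (with a = 0): leave x = (a,0) and y = (b,0) white;
  -- x′ = (a,1) forces y, then y′ = (b,1) forces x.
  fromEdge : ∃[ b ] Adj G fzero b → Z≤ (lex G (empty k)) (n * k ∸ 2)
  fromEdge (b , a~b) =
    let S , unique , covers , bound = allButTwo _≟_ (listing-Fin× n k) x≢y
    in  S , unique , forceTwo _≟_ (lex G (empty k))
                       {x = fzero , fzero} {y = b , fzero} {x′ = fzero , fsuc fzero} {y′ = b , fsuc fzero}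
                       (λ ()) (λ ())
                       (lex-lift G (empty k) (fsuc fzero) fzero a~b)
                       (lex-empty-column G k (fsuc fzero) fzero)
                       (lex-lift G (empty k) (fsuc fzero) fzero (sym G a~b))
                       S covers
          , bound
    where
    x≢y : ¬ (fzero , fzero) ≡ (b , fzero)
    x≢y refl = irrefl G a~b
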